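{- A permutation $\pi\in S_n$ has a direct tangle (a tangle solving $\pi$ in which every path has at most $2$ corners) if and only if $\pi$ is $321$-avoiding.
   Context: $S_n$ is the set of permutations $\pi=[\pi(1),\dots,\pi(n)]$ of $\{1,\dots,n\}$, where $\pi(p)$ is the element at position $p$. For $1\le i<n$, the swap $\sigma(i)$ transforms $\pi$ into $\pi\cdot\sigma(i)$ by exchanging the elements in positions $i$ and $i+1$. Two permutations are adjacent if one is obtained from the other by applying swaps $\sigma(p_1),\dots,\sigma(p_k)$ ($k\ge 0$) with $|p_i-p_j|\ge 2$ for $i\ne j$. A tangle is a finite sequence $\pi_0,\dots,\pi_m$ of permutations in $S_n$ in which consecutive permutations are adjacent; it solves $\pi$ if $\pi_0=\pi$ and $\pi_m$ is the identity; by convention the first and last permutations are repeated ($\pi_0=\pi_1$, $\pi_{m-1}=\pi_m$). In the drawing of the tangle, element $x$ at time $t$ is placed at the point $(p,-t)$ where $\pi_t(p)=x$, and path $x$ is the polyline joining these points for $t=0,\dots,m$; its pieces are vertical or at $\pm45^\circ$ to the vertical. A corner of a path is a point where it changes direction, counted with multiplicity (a change between the two diagonal directions counts as $2$). A permutation $\pi\in S_n$ contains a pattern $\mu\in S_k$ if there are positions $i_1<\dots<i_k$ such that for all $r<s$, $\pi(i_r)<\pi(i_s)$ iff $\mu(r)<\mu(s)$; otherwise it avoids $\mu$. $321$-avoiding means avoiding $\mu=[3,2,1]$. -}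

module Defs where

open import Data.Nat using (ℕ; zero; suc; _+_; _≤_; _<_; _≡ᵇ_)
open import Data.Integer as ℤ using (ℤ; +_; _-_; ∣_∣)
open import Data.Fin using (Fin; toℕ)
open import Data.Fin.Permutation using (Permutation′; _⟨$⟩ʳ_; _⟨$⟩ˡ_; _≈_; id; reverse)
open import Data.Bool using (if_then_else_)
open import Data.List using (List)
open import Data.List.Relation.Unary.All using (All)
open import Data.List.Relation.Unary.AllPairs using (AllPairs)
open import Data.Product using (Σ; ∃; _×_)
open import Data.Sum using (_⊎_)
open import Relation.Binary.PropositionalEquality using (_≡_)
open import Relation.Nullary using (¬_)

-- Conventions: positions and elements are 0-indexed (Fin n), i.e. the
-- paper's position p / element x correspond to p-1 / x-1 here.
-- A permutation π ∈ S_n is  π : Permutation′ n , with π(p) = π ⟨$⟩ʳ p.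

-- The swap σ(i) (0-indexed: exchanges positions i and i+1), acting on
-- positions:  (π · σ(i))(q) = π(swapPos i q).
swapPos : ℕ → ℕ → ℕ
swapPos i q = if q ≡ᵇ i then suc i else (if q ≡ᵇ suc i then i else q)

-- (π · σ(p₁) · … · σ(pₖ))(q) = π(applySwaps [p₁,…,pₖ] q)
applySwaps : List ℕ → ℕ → ℕ
applySwaps Data.List.[] q = q
applySwaps (p Data.List.∷ ps) q = swapPos p (applySwaps ps q)

FarApart : ℕ → ℕ → Set
FarApart i j = (suc i < j) ⊎ (suc j < i)

Adjacent : ∀ {n} → Permutation′ n → Permutation′ n → Set
Adjacent {n} π π' =
  Σ (List ℕ) λ ps →
    All (λ i → suc i < n) ps ×
    AllPairs FarApart ps ×
    (∀ (p q : Fin n) → toℕ q ≡ applySwaps ps (toℕ p) → π' ⟨$⟩ʳ p ≡ π ⟨$⟩ʳ q)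

-- A tangle π₀,…,π_m (given by τ t = π_t for t ≤ m; values for t > m are
-- irrelevant) solving π, including the convention π₀ = π₁, π_{m-1} = π_m.
record Tangle {n : ℕ} (π : Permutation′ n) : Set where
  field
    m        : ℕ
    τ        : ℕ → Permutation′ n
    m≥1      : 1 ≤ m
    start    : τ 0 ≈ π
    finish   : τ m ≈ id
    adjacent : ∀ t → t < m → Adjacent (τ t) (τ (suc t))
    repFirst : τ 0 ≈ τ 1
    repLast  : τ (Data.Nat._∸_ m 1) ≈ τ m

sumTo : ℕ → (ℕ → ℕ) → ℕ
sumTo zero    f = 0
sumTo (suc k) f = sumTo k f + f k

module _ {n : ℕ} {π : Permutation′ n} (T : Tangle π) where
  open Tangle T

  -- horizontal coordinate of path x at time t (its position in π_t)
  pathPos : Fin n → ℕ → ℤ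
  pathPos x t = + toℕ (τ t ⟨$⟩ˡ x)

  -- horizontal displacement of the piece of path x from time t to t+1
  -- (0 = vertical, ±1 = diagonal)
  step : Fin n → ℕ → ℤ
  step x t = pathPos x (suc t) - pathPos x t

  -- number of corners of path x, with multiplicity: at the point at time
  -- t+1 (0 ≤ t ≤ m-2) the direction changes by |step(t+1) - step(t)|,
  -- which is 1 for vertical↔diagonal and 2 for diagonal↔other diagonal.
  corners : Fin n → ℕ
  corners x = sumTo (Data.Nat._∸_ m 1) (λ t → ∣ step x (suc t) - step x t ∣)

Direct : ∀ {n} {π : Permutation′ n} → Tangle π → Set
Direct {n} T = ∀ (x : Fin n) → corners T x ≤ 2

HasDirectTangle : ∀ {n} → Permutation′ n → Set
HasDirectTangle π = Σ (Tangle π) Direct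

Contains : ∀ {n k} → Permutation′ n → Permutation′ k → Set
Contains {n} {k} π μ =
  Σ (Fin k → Fin n) λ i →
    (∀ r s → toℕ r < toℕ s → toℕ (i r) < toℕ (i s)) ×
    (∀ r s → toℕ r < toℕ s →
       (toℕ (π ⟨$⟩ʳ i r) < toℕ (π ⟨$⟩ʳ i s) → toℕ (μ ⟨$⟩ʳ r) < toℕ (μ ⟨$⟩ʳ s)) ×
       (toℕ (μ ⟨$⟩ʳ r) < toℕ (μ ⟨$⟩ʳ s) → toℕ (π ⟨$⟩ʳ i r) < toℕ (π ⟨$⟩ʳ i s)))

Avoids : ∀ {n k} → Permutation′ n → Permutation′ k → Set
Avoids π μ = ¬ Contains π μ

-- the pattern [3,2,1] ∈ S_3 (the reversal permutation: p ↦ 2 - p, 0-indexed)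
pattern321 : Permutation′ 3
pattern321 = reverse

Avoids321 : ∀ {n} → Permutation′ n → Set
Avoids321 π = Avoids π pattern321

-- In a 321-avoiding permutation every element is the left end of inversions only (it must
-- move right), the right end of inversions only (it must move left), or of none.  Undo the
-- inversion (a, b) in step n + 1 + #{left-movers before b} − #{right-movers before a}: the
-- exchanges of one step are disjoint adjacent transpositions, and the steps in which a given
-- element moves are consecutive, so its path is vertical, diagonal in one direction, vertical
-- again: at most two corners.  Conversely, if positions i < j < k carry a 321 pattern, the
-- middle element must be overtaken by the larger one (a step left) and by the smaller one (a
-- step right), and paths start vertically, so its path has at least 1 + 2 corners.

module Submission where

open import Defs
open import Data.Bool using (true; false)
open import Data.Empty using (⊥; ⊥-elim)
open import Data.Fin as Fin using (Fin; toℕ; fromℕ<)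
open import Data.Fin.Patterns using (0F; 1F; 2F)
open import Data.Fin.Permutation as Perm using (Permutation′; _⟨$⟩ʳ_; _⟨$⟩ˡ_; inverseˡ; inverseʳ; _∘ₚ_)
open import Data.Fin.Properties using (toℕ-fromℕ<; fromℕ<-toℕ; toℕ-injective; toℕ<n; injective⇒≤; punchOut-injective; any?)
open import Data.Integer as ℤ using (ℤ; 0ℤ; 1ℤ; -1ℤ; ∣_∣)
import Data.Integer.Properties as ℤ
open import Data.List using (List; []; _∷_)
open import Data.List.Membership.Propositional using (_∈_; _∉_)
open import Data.List.Relation.Unary.All as All using (All; []; _∷_)
open import Data.List.Relation.Unary.AllPairs using (AllPairs; []; _∷_)
open import Data.List.Relation.Unary.Any using (here; there)
open import Data.Nat
  using (ℕ; zero; suc; _+_; _∸_; _⊓_; _≤_; _<_; _≤?_; _<?_; _≟_; _≡ᵇ_; _≤′_; ≤′-refl; ≤′-step; z≤n; s≤s; s≤s⁻¹)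
open import Data.List.Membership.DecPropositional _≟_ using (_∈?_)
open import Data.Nat.Properties
open import Data.Product using (∃; ∃₂; _×_; _,_; proj₁; proj₂; map₁; map₂; uncurry)
open import Data.Sum as Sum using (_⊎_; inj₁; inj₂; [_,_]′)
open import Function using (_∘_; id)
open import Function.Bundles using (_⇔_; mk⇔)
open import Function.Definitions using (Injective)
open import Relation.Binary.Definitions using (tri<; tri≈; tri>)
open import Relation.Binary.PropositionalEquality
open import Relation.Nullary using (¬_; Dec; yes; no; contradiction)
open import Relation.Nullary.Decidable using (dec-true; dec-false; map′; _×-dec_; _⊎-dec_; ¬?)
open import Relation.Unary using (Decidable)

module _ {P : ℕ → Set} (P? : Decidable P) where

  count : ℕ → ℕ
  count zero = 0
  count (suc k) with P? k
  ... | yes _ = suc (count k)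
  ... | no  _ = count k

  count-suc-yes : ∀ {k} → P k → count (suc k) ≡ suc (count k)
  count-suc-yes {k} pk with P? k
  ... | yes _  = refl
  ... | no ¬pk = contradiction pk ¬pk

  count-≤ : ∀ k → count k ≤ k
  count-≤ zero = z≤n
  count-≤ (suc k) with P? k
  ... | yes _ = s≤s (count-≤ k)
  ... | no  _ = m≤n⇒m≤1+n (count-≤ k)

  count-≤-suc : ∀ k → count k ≤ count (suc k)
  count-≤-suc k with P? k
  ... | yes _ = n≤1+n (count k)
  ... | no  _ = ≤-refl

  count-monoʳ : ∀ {j k} → j ≤ k → count j ≤ count k
  count-monoʳ {k = zero}  z≤n = ≤-refl
  count-monoʳ {j} {suc k} j≤1+k with m≤n⇒m<n∨m≡n j≤1+k
  ... | inj₁ j<1+k = ≤-trans (count-monoʳ (s≤s⁻¹ j<1+k)) (count-≤-suc k)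
  ... | inj₂ refl  = ≤-refl

  count-< : ∀ {j k} → j < k → ¬ P j → count k < k
  count-< {j} {suc k} j<1+k ¬pj with P? k | j ≟ k
  ... | yes pk | yes refl = contradiction pk ¬pj
  ... | yes _  | no j≢k   = s≤s (count-< (≤∧≢⇒< (s≤s⁻¹ j<1+k) j≢k) ¬pj)
  ... | no  _  | _        = s≤s (count-≤ k)

  count-ivt : ∀ {b₁ b₂ c} → count b₁ ≤ c → c < count b₂ →
              ∃ λ j → b₁ ≤ j × j < b₂ × P j × count j ≡ c
  count-ivt {b₁} {suc b₂} {c} b₁≤c c<b₂ with b₁ ≤? b₂
  ... | no b₁≰b₂ = contradiction (≤-trans (count-monoʳ (≰⇒> b₁≰b₂)) b₁≤c) (<⇒≱ c<b₂)
  ... | yes b₁≤b₂ with P? b₂ | count b₂ ≟ c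
  ...   | yes pb₂ | yes refl = b₂ , b₁≤b₂ , ≤-refl , pb₂ , refl
  ...   | yes _   | no b₂≢c  =
    map₂ (map₂ (map₁ m≤n⇒m≤1+n)) (count-ivt b₁≤c (≤∧≢⇒< (s≤s⁻¹ c<b₂) (b₂≢c ∘ sym)))
  ...   | no  _   | _        = map₂ (map₂ (map₁ m≤n⇒m≤1+n)) (count-ivt b₁≤c c<b₂)

module _ {P Q : ℕ → Set} (P? : Decidable P) (Q? : Decidable Q) where

  count-mono : ∀ k → (∀ {i} → i < k → P i → Q i) → count P? k ≤ count Q? k
  count-mono zero    _ = z≤n
  count-mono (suc k) P⊆Q with P? k | Q? k
  ... | yes _  | yes _  = s≤s (count-mono k (P⊆Q ∘ m<n⇒m<1+n))
  ... | yes pk | no ¬qk = contradiction (P⊆Q ≤-refl pk) ¬qk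
  ... | no  _  | yes _  = m≤n⇒m≤1+n (count-mono k (P⊆Q ∘ m<n⇒m<1+n))
  ... | no  _  | no  _  = count-mono k (P⊆Q ∘ m<n⇒m<1+n)

  count-mono-< : ∀ k {j} → j < k → ¬ P j → Q j → (∀ {i} → i < k → P i → Q i) →
                 count P? k < count Q? k
  count-mono-< (suc k) {j} j<1+k ¬pj qj P⊆Q with P? k | Q? k | k ≟ j
  ... | yes pk | _      | yes refl = contradiction pk ¬pj
  ... | no  _  | no ¬qk | yes refl = contradiction qj ¬qk
  ... | no  _  | yes _  | yes refl = s≤s (count-mono k (P⊆Q ∘ m<n⇒m<1+n))
  ... | yes pk | no ¬qk | no _     = contradiction (P⊆Q ≤-refl pk) ¬qk
  ... | yes _  | yes _  | no k≢j   = s≤s (count-mono-< k (≤∧≢⇒< (s≤s⁻¹ j<1+k) (k≢j ∘ sym)) ¬pj qj (P⊆Q ∘ m<n⇒m<1+n))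
  ... | no  _  | yes _  | no k≢j   =
    m<n⇒m<1+n (count-mono-< k (≤∧≢⇒< (s≤s⁻¹ j<1+k) (k≢j ∘ sym)) ¬pj qj (P⊆Q ∘ m<n⇒m<1+n))
  ... | no  _  | no  _  | no k≢j   = count-mono-< k (≤∧≢⇒< (s≤s⁻¹ j<1+k) (k≢j ∘ sym)) ¬pj qj (P⊆Q ∘ m<n⇒m<1+n)

module _ {P Q : ℕ → Set} (P? : Decidable P) (Q? : Decidable Q) where

  count-cong : ∀ k → (∀ {i} → i < k → P i → Q i) → (∀ {i} → i < k → Q i → P i) →
               count P? k ≡ count Q? k
  count-cong k P⊆Q Q⊆P = ≤-antisym (count-mono P? Q? k P⊆Q) (count-mono Q? P? k Q⊆P)

  count-insert : ∀ k {j} → j < k → ¬ P j → Q j →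
                 (∀ {i} → i < k → i ≢ j → P i → Q i) → (∀ {i} → i < k → i ≢ j → Q i → P i) →
                 count Q? k ≡ suc (count P? k)
  count-insert (suc k) {j} j<1+k ¬pj qj P⊆Q Q⊆P with P? k | Q? k | k ≟ j
  ... | yes pk | _      | yes refl = contradiction pk ¬pj
  ... | _      | no ¬qk | yes refl = contradiction qj ¬qk
  ... | no  _  | yes _  | yes refl =
    cong suc (sym (count-cong k (λ i<k → P⊆Q (m<n⇒m<1+n i<k) (<⇒≢ i<k))
                                (λ i<k → Q⊆P (m<n⇒m<1+n i<k) (<⇒≢ i<k))))
  ... | yes pk | no ¬qk | no k≢j = contradiction (P⊆Q ≤-refl k≢j pk) ¬qk
  ... | no ¬pk | yes qk | no k≢j = contradiction (Q⊆P ≤-refl k≢j qk) ¬pk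
  ... | yes _  | yes _  | no k≢j =
    cong suc (count-insert k (≤∧≢⇒< (s≤s⁻¹ j<1+k) (k≢j ∘ sym)) ¬pj qj (P⊆Q ∘ m<n⇒m<1+n) (Q⊆P ∘ m<n⇒m<1+n))
  ... | no  _  | no  _  | no k≢j =
    count-insert k (≤∧≢⇒< (s≤s⁻¹ j<1+k) (k≢j ∘ sym)) ¬pj qj (P⊆Q ∘ m<n⇒m<1+n) (Q⊆P ∘ m<n⇒m<1+n)

count-<? : ∀ a k → count (_<? a) k ≡ k ⊓ a
count-<? a zero = refl
count-<? a (suc k) with k <? a
... | yes k<a = begin
  suc (count (_<? a) k) ≡⟨ cong suc (count-<? a k) ⟩
  suc (k ⊓ a)           ≡⟨ cong suc (m≤n⇒m⊓n≡m (<⇒≤ k<a)) ⟩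
  suc k                 ≡⟨ m≤n⇒m⊓n≡m k<a ⟨
  suc k ⊓ a             ∎
  where open ≡-Reasoning
... | no k≮a = begin
  count (_<? a) k ≡⟨ count-<? a k ⟩
  k ⊓ a           ≡⟨ m≥n⇒m⊓n≡n (≮⇒≥ k≮a) ⟩
  a               ≡⟨ m≥n⇒m⊓n≡n (m≤n⇒m≤1+n (≮⇒≥ k≮a)) ⟨
  suc k ⊓ a       ∎
  where open ≡-Reasoning

≡ᵇ-refl : ∀ i → (i ≡ᵇ i) ≡ true
≡ᵇ-refl i = dec-true (i ≟ i) refl

≢⇒≡ᵇ-false : ∀ {i j} → i ≢ j → (i ≡ᵇ j) ≡ false
≢⇒≡ᵇ-false {i} {j} = dec-false (i ≟ j)

swapPos-left : ∀ i → swapPos i i ≡ suc i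
swapPos-left i rewrite ≡ᵇ-refl i = refl

swapPos-right : ∀ i → swapPos i (suc i) ≡ i
swapPos-right i rewrite ≢⇒≡ᵇ-false (1+n≢n {i}) | ≡ᵇ-refl (suc i) = refl

swapPos-fixes : ∀ {i q} → q ≢ i → q ≢ suc i → swapPos i q ≡ q
swapPos-fixes q≢i q≢1+i rewrite ≢⇒≡ᵇ-false q≢i | ≢⇒≡ᵇ-false q≢1+i = refl

swapPos-< : ∀ {n i q} → suc i < n → q < n → swapPos i q < n
swapPos-< {i = i} {q} 1+i<n q<n with q ≟ i | q ≟ suc i
... | yes refl | _        = subst (_< _) (sym (swapPos-left i)) 1+i<n
... | no  _    | yes refl = subst (_< _) (sym (swapPos-right i)) (<-trans (n<1+n i) 1+i<n)
... | no q≢i   | no q≢1+i = subst (_< _) (sym (swapPos-fixes q≢i q≢1+i)) q<n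

applySwaps-< : ∀ {n ps q} → All (λ i → suc i < n) ps → q < n → applySwaps ps q < n
applySwaps-< []           q<n = q<n
applySwaps-< (1+p<n ∷ ps) q<n = swapPos-< 1+p<n (applySwaps-< ps q<n)

applySwaps-fixes : ∀ {ps q} → All (λ i → q ≢ i × q ≢ suc i) ps → applySwaps ps q ≡ q
applySwaps-fixes [] = refl
applySwaps-fixes ((q≢p , q≢1+p) ∷ rest) rewrite applySwaps-fixes rest = swapPos-fixes q≢p q≢1+p

FarApart-sym : ∀ {p q} → FarApart p q → FarApart q p
FarApart-sym = [ inj₂ , inj₁ ]′

FarApart⇒fixes : ∀ {p q} → FarApart p q → (q ≢ p × q ≢ suc p) × (suc q ≢ p × suc q ≢ suc p)
FarApart⇒fixes (inj₁ 2+p≤q) = (<⇒≢ (<-trans (n<1+n _) 2+p≤q) ∘ sym , <⇒≢ 2+p≤q ∘ sym)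
                            , (<⇒≢ (<-trans (<-trans (n<1+n _) 2+p≤q) (n<1+n _)) ∘ sym , <⇒≢ (<-trans 2+p≤q (n<1+n _)) ∘ sym)
FarApart⇒fixes (inj₂ 2+q≤p) = (<⇒≢ (<-trans (n<1+n _) 2+q≤p) , <⇒≢ (<-trans (<-trans (n<1+n _) 2+q≤p) (n<1+n _)))
                            , (<⇒≢ 2+q≤p , <⇒≢ (<-trans 2+q≤p (n<1+n _)))

applySwaps-∈ : ∀ {ps q} → AllPairs FarApart ps → q ∈ ps → applySwaps ps q ≡ suc q
applySwaps-∈ {p ∷ _} (far ∷ _) (here refl)
  rewrite applySwaps-fixes (All.map (proj₁ ∘ FarApart⇒fixes ∘ FarApart-sym) far) = swapPos-left p
applySwaps-∈ (far ∷ fars) (there q∈ps) rewrite applySwaps-∈ fars q∈ps =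
  uncurry swapPos-fixes (proj₂ (FarApart⇒fixes (All.lookup far q∈ps)))

applySwaps-suc-∈ : ∀ {ps q} → AllPairs FarApart ps → q ∈ ps → applySwaps ps (suc q) ≡ q
applySwaps-suc-∈ {p ∷ _} (far ∷ _) (here refl)
  rewrite applySwaps-fixes (All.map (proj₂ ∘ FarApart⇒fixes ∘ FarApart-sym) far) = swapPos-right p
applySwaps-suc-∈ (far ∷ fars) (there q∈ps) rewrite applySwaps-suc-∈ fars q∈ps =
  uncurry swapPos-fixes (proj₁ (FarApart⇒fixes (All.lookup far q∈ps)))

applySwaps-∉ : ∀ {ps q} → q ∉ ps → (∀ {s} → q ≡ suc s → s ∉ ps) → applySwaps ps q ≡ q
applySwaps-∉ q∉ps pred∉ps =
  applySwaps-fixes (All.tabulate λ p∈ps → (λ { refl → q∉ps p∈ps }) , λ q≡1+p → pred∉ps q≡1+p p∈ps)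

applySwaps-near : ∀ {ps} → AllPairs FarApart ps → ∀ q → applySwaps ps q ≤ suc q × q ≤ suc (applySwaps ps q)
applySwaps-near fars q with q ∈? _
... | yes q∈ps rewrite applySwaps-∈ fars q∈ps = ≤-refl , m≤n⇒m≤1+n (n≤1+n q)
applySwaps-near fars zero | no 0∉ps rewrite applySwaps-∉ 0∉ps (λ ()) = n≤1+n 0 , n≤1+n 0
applySwaps-near fars (suc s) | no 1+s∉ps with s ∈? _
... | yes s∈ps rewrite applySwaps-suc-∈ fars s∈ps = m≤n⇒m≤1+n (n≤1+n s) , ≤-refl
... | no s∉ps rewrite applySwaps-∉ 1+s∉ps (λ { refl → s∉ps }) = n≤1+n (suc s) , n≤1+n (suc s)

module _ {P : ℕ → Set} (P? : Decidable P) where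

  positionsWhere : ℕ → List ℕ
  positionsWhere zero = []
  positionsWhere (suc k) with P? k
  ... | yes _ = k ∷ positionsWhere k
  ... | no  _ = positionsWhere k

  ∈-positionsWhere⁻ : ∀ {k s} → s ∈ positionsWhere k → s < k × P s
  ∈-positionsWhere⁻ {suc k} s∈ with P? k | s∈
  ... | yes pk | here refl = ≤-refl , pk
  ... | yes _  | there s∈′ = map₁ m<n⇒m<1+n (∈-positionsWhere⁻ s∈′)
  ... | no  _  | s∈′       = map₁ m<n⇒m<1+n (∈-positionsWhere⁻ s∈′)

  ∈-positionsWhere⁺ : ∀ {k s} → s < k → P s → s ∈ positionsWhere k
  ∈-positionsWhere⁺ {suc k} {s} s<1+k ps with P? k | s ≟ k
  ... | yes _  | yes refl = here refl
  ... | no ¬pk | yes refl = contradiction ps ¬pk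
  ... | yes _  | no s≢k   = there (∈-positionsWhere⁺ (≤∧≢⇒< (s≤s⁻¹ s<1+k) s≢k) ps)
  ... | no  _  | no s≢k   = ∈-positionsWhere⁺ (≤∧≢⇒< (s≤s⁻¹ s<1+k) s≢k) ps

  positionsWhere-farApart : (∀ {s} → P s → ¬ P (suc s)) → ∀ k → AllPairs FarApart (positionsWhere k)
  positionsWhere-farApart isolated zero = []
  positionsWhere-farApart isolated (suc k) with P? k
  ... | no  _  = positionsWhere-farApart isolated k
  ... | yes pk = All.tabulate far ∷ positionsWhere-farApart isolated k
    where
    far : ∀ {s} → s ∈ positionsWhere k → FarApart k s
    far s∈ with ∈-positionsWhere⁻ s∈
    ... | s<k , ps = inj₂ (≤∧≢⇒< s<k λ { refl → isolated ps pk })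

∣i-k∣≤∣i-j∣+∣j-k∣ : ∀ i j k → ∣ i ℤ.- k ∣ ≤ ∣ i ℤ.- j ∣ + ∣ j ℤ.- k ∣
∣i-k∣≤∣i-j∣+∣j-k∣ i j k =
  subst (λ x → ∣ x ∣ ≤ ∣ i ℤ.- j ∣ + ∣ j ℤ.- k ∣) (ℤ.+-minus-telescope i j k)
        (ℤ.∣i+j∣≤∣i∣+∣j∣ (i ℤ.- j) (j ℤ.- k))

+[1+m]-+m≡1 : ∀ m → ℤ.+ suc m ℤ.- ℤ.+ m ≡ 1ℤ
+[1+m]-+m≡1 m = trans (ℤ.[+m]-[+n]≡m⊖n (suc m) m) (trans (ℤ.⊖-≥ (n≤1+n m)) (cong ℤ.+_ (m+n∸n≡m 1 m)))

+m-+[1+m]≡-1 : ∀ m → ℤ.+ m ℤ.- ℤ.+ suc m ≡ -1ℤ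
+m-+[1+m]≡-1 m = begin
  ℤ.+ m ℤ.- ℤ.+ suc m        ≡⟨ ℤ.[+m]-[+n]≡m⊖n m (suc m) ⟩
  m ℤ.⊖ suc m                ≡⟨ ℤ.⊖-swap m (suc m) ⟩
  ℤ.- (suc m ℤ.⊖ m)          ≡⟨ cong ℤ.-_ (ℤ.[+m]-[+n]≡m⊖n (suc m) m) ⟨
  ℤ.- (ℤ.+ suc m ℤ.- ℤ.+ m)  ≡⟨ cong ℤ.-_ (+[1+m]-+m≡1 m) ⟩
  -1ℤ                        ∎
  where open ≡-Reasoning

module _ (s : ℕ → ℤ) where

  variation : ℕ → ℕ
  variation N = sumTo N (λ t → ∣ s (suc t) ℤ.- s t ∣)

  variation-split : ∀ {i N} → i ≤ N → variation i + ∣ s N ℤ.- s i ∣ ≤ variation N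
  variation-split {i} i≤N = go (≤⇒≤′ i≤N)
    where
    go : ∀ {N} → i ≤′ N → variation i + ∣ s N ℤ.- s i ∣ ≤ variation N
    go ≤′-refl rewrite ℤ.+-inverseʳ (s i) = ≤-reflexive (+-identityʳ (variation i))
    go (≤′-step {N} i≤′N) = begin
      variation i + ∣ s (suc N) ℤ.- s i ∣           ≤⟨ +-monoʳ-≤ (variation i) (∣i-k∣≤∣i-j∣+∣j-k∣ (s (suc N)) (s N) (s i)) ⟩
      variation i + (last + ∣ s N ℤ.- s i ∣)       ≡⟨ cong (variation i +_) (+-comm last _) ⟩
      variation i + (∣ s N ℤ.- s i ∣ + last)       ≡⟨ +-assoc (variation i) _ last ⟨
      variation i + ∣ s N ℤ.- s i ∣ + last         ≤⟨ +-monoˡ-≤ last (go i≤′N) ⟩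
      variation N + last                           ∎
      where
      open ≤-Reasoning
      last = ∣ s (suc N) ℤ.- s N ∣

  variation-≥-path : ∀ {a b N} → a ≤ b → b ≤ N → ∣ s a ℤ.- s 0 ∣ + ∣ s b ℤ.- s a ∣ ≤ variation N
  variation-≥-path {a} {b} {N} a≤b b≤N = begin
    ∣ s a ℤ.- s 0 ∣ + ∣ s b ℤ.- s a ∣ ≤⟨ +-monoˡ-≤ _ (variation-split z≤n) ⟩
    variation a + ∣ s b ℤ.- s a ∣     ≤⟨ variation-split a≤b ⟩
    variation b                       ≤⟨ m≤m+n (variation b) _ ⟩
    variation b + ∣ s N ℤ.- s b ∣     ≤⟨ variation-split b≤N ⟩
    variation N                       ∎
    where open ≤-Reasoning

  -- leaving 0 in both directions costs 1 + 2
  three≤variation : ∀ {t₁ t₂ N} → s 0 ≡ 0ℤ → s t₁ ≡ -1ℤ → s t₂ ≡ 1ℤ → t₁ ≤ N → t₂ ≤ N →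
                    3 ≤ variation N
  three≤variation {t₁} {t₂} {N} s₀ s₁ s₂ t₁≤N t₂≤N with ≤-total t₁ t₂
  ... | inj₁ t₁≤t₂ =
    subst (_≤ variation N) (cong₂ _+_ (cong₂ dist s₁ s₀) (cong₂ dist s₂ s₁)) (variation-≥-path t₁≤t₂ t₂≤N)
    where dist = λ x y → ∣ x ℤ.- y ∣
  ... | inj₂ t₂≤t₁ =
    subst (_≤ variation N) (cong₂ _+_ (cong₂ dist s₂ s₀) (cong₂ dist s₁ s₂)) (variation-≥-path t₂≤t₁ t₁≤N)
    where dist = λ x y → ∣ x ℤ.- y ∣

  variation≤2 : ∀ {d} → ∣ d ∣ ≡ 1 → s 0 ≡ 0ℤ → (∀ t → s t ≡ 0ℤ ⊎ s t ≡ d) →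
                (∀ {t₁ t t₂} → t₁ < t → t < t₂ → s t₁ ≡ d → s t₂ ≡ d → s t ≡ d) →
                ∀ N → variation N ≤ 2
  variation≤2 {d} ∣d∣≡1 s₀ values interval N =
    [ (λ sN≡0 → [ (λ var≡0 → ≤-trans (≤-reflexive var≡0) z≤n) , proj₁ ]′ (proj₂ (invariant N) sN≡0)) ,
      (λ sN≡d → ≤-trans (proj₁ (invariant N) sN≡d) (n≤1+n 1)) ]′ (values N)
    where
    not-both : ∀ {t} → s t ≡ d → s t ≡ 0ℤ → ⊥
    not-both st≡d st≡0 = 1+n≢0 (trans (sym ∣d∣≡1) (cong ∣_∣ (trans (sym st≡d) st≡0)))

    variation-suc : ∀ {N x y k} → s (suc N) ≡ x → s N ≡ y → ∣ x ℤ.- y ∣ ≡ k → variation (suc N) ≡ variation N + k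
    variation-suc {N} refl refl = cong (variation N +_)

    ∣0-0∣ : ∣ 0ℤ ℤ.- 0ℤ ∣ ≡ 0
    ∣0-0∣ = refl

    ∣d-d∣ : ∣ d ℤ.- d ∣ ≡ 0
    ∣d-d∣ = cong ∣_∣ (ℤ.+-inverseʳ d)

    ∣d-0∣ : ∣ d ℤ.- 0ℤ ∣ ≡ 1
    ∣d-0∣ = trans (cong ∣_∣ (ℤ.+-identityʳ d)) ∣d∣≡1

    ∣0-d∣ : ∣ 0ℤ ℤ.- d ∣ ≡ 1
    ∣0-d∣ = trans (cong ∣_∣ (ℤ.+-identityˡ (ℤ.- d))) (trans (ℤ.∣-i∣≡∣i∣ d) ∣d∣≡1)

    -- by contiguity, once s has returned from d to 0 it stays 0
    invariant : ∀ N → (s N ≡ d → variation N ≤ 1) ×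
                      (s N ≡ 0ℤ → variation N ≡ 0 ⊎ variation N ≤ 2 × ∃ λ t → t < N × s t ≡ d)
    invariant zero = (λ _ → z≤n) , (λ _ → inj₁ refl)
    invariant (suc N) with invariant N | values N | values (suc N)
    ... | _ , before | inj₁ sN≡0 | inj₁ s1+N≡0 =
      (λ s1+N≡d → ⊥-elim (not-both s1+N≡d s1+N≡0)) ,
      λ _ → Sum.map (λ var≡0 → trans no-move (cong (_+ 0) var≡0))
                         (λ (var≤2 , t , t<N , st≡d) → ≤-trans (≤-reflexive (trans no-move (+-identityʳ _))) var≤2 ,
                                                       t , m<n⇒m<1+n t<N , st≡d)
                         (before sN≡0)
      where no-move = variation-suc s1+N≡0 sN≡0 ∣0-0∣
    ... | now , _ | inj₂ sN≡d | inj₂ s1+N≡d =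
      (λ _ → ≤-trans (≤-reflexive (trans (variation-suc s1+N≡d sN≡d ∣d-d∣) (+-identityʳ _))) (now sN≡d)) ,
      λ s1+N≡0 → ⊥-elim (not-both s1+N≡d s1+N≡0)
    ... | _ , before | inj₁ sN≡0 | inj₂ s1+N≡d =
      (λ _ → [ (λ var≡0 → ≤-reflexive (trans (variation-suc s1+N≡d sN≡0 ∣d-0∣) (cong (_+ 1) var≡0))) ,
               (λ (_ , t , t<N , st≡d) → ⊥-elim (not-both (interval t<N (n<1+n N) st≡d s1+N≡d) sN≡0)) ]′
             (before sN≡0)) ,
      λ s1+N≡0 → ⊥-elim (not-both s1+N≡d s1+N≡0)
    ... | now , _ | inj₂ sN≡d | inj₁ s1+N≡0 =
      (λ s1+N≡d → ⊥-elim (not-both s1+N≡d s1+N≡0)) ,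
      λ _ → inj₂ (≤-trans (≤-reflexive (variation-suc s1+N≡0 sN≡d ∣0-d∣)) (+-monoˡ-≤ 1 (now sN≡d)) ,
                  N , n<1+n N , sN≡d)

sumTo-cong : ∀ {f g} → (∀ t → f t ≡ g t) → ∀ N → sumTo N f ≡ sumTo N g
sumTo-cong f≗g zero    = refl
sumTo-cong f≗g (suc N) = cong₂ _+_ (sumTo-cong f≗g N) (f≗g N)

variation-cong : ∀ {s s′} → (∀ t → s t ≡ s′ t) → ∀ N → variation s N ≡ variation s′ N
variation-cong s≗s′ = sumTo-cong λ t → cong₂ (λ x y → ∣ x ℤ.- y ∣) (s≗s′ (suc t)) (s≗s′ t)

-- Elements are named by their initial position a < n, where they carry the value v a.
module Schedule (n : ℕ) (v : ℕ → ℕ)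
  (v-injective : ∀ {a b} → a < n → b < n → v a ≡ v b → a ≡ b)
  (no321 : ∀ {a b c} → a < b → b < c → c < n → v b < v a → v c < v b → ⊥) where

  Inversion : ℕ → ℕ → Set
  Inversion a b = a < b × b < n × v b < v a

  inversion? : ∀ a b → Dec (Inversion a b)
  inversion? a b = a <? b ×-dec b <? n ×-dec v b <? v a

  RightMover LeftMover : ℕ → Set
  RightMover a = ∃ λ b → b < n × Inversion a b
  LeftMover  b = ∃ λ a → a < n × Inversion a b

  rightMover? : Decidable RightMover
  rightMover? a = anyUpTo? (inversion? a) n

  leftMover? : Decidable LeftMover
  leftMover? b = anyUpTo? (λ a → inversion? a b) n

  inversion⇒rightMover : ∀ {a b} → Inversion a b → RightMover a
  inversion⇒rightMover inv@(_ , b<n , _) = _ , b<n , inv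

  inversion⇒leftMover : ∀ {a b} → Inversion a b → LeftMover b
  inversion⇒leftMover inv@(a<b , b<n , _) = _ , <-trans a<b b<n , inv

  rightMover⇒¬leftMover : ∀ {a} → RightMover a → ¬ LeftMover a
  rightMover⇒¬leftMover (_ , _ , a<c , c<n , vc<va) (_ , _ , b<a , _ , va<vb) = no321 b<a a<c c<n va<vb vc<va

  leftMover-< : ∀ {a b} → LeftMover a → a < b → b < n → v a < v b
  leftMover-< {a} {b} left a<b b<n with <-cmp (v a) (v b)
  ... | tri< va<vb _ _ = va<vb
  ... | tri≈ _ va≡vb _ = contradiction (v-injective (<-trans a<b b<n) b<n va≡vb) (<⇒≢ a<b)
  ... | tri> _ _ vb<va = contradiction left (rightMover⇒¬leftMover (inversion⇒rightMover (a<b , b<n , vb<va)))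

  rightMover-< : ∀ {a b} → RightMover b → a < b → b < n → v a < v b
  rightMover-< {a} {b} right a<b b<n with <-cmp (v a) (v b)
  ... | tri< va<vb _ _ = va<vb
  ... | tri≈ _ va≡vb _ = contradiction (v-injective (<-trans a<b b<n) b<n va≡vb) (<⇒≢ a<b)
  ... | tri> _ _ vb<va = contradiction (inversion⇒leftMover (a<b , b<n , vb<va)) (rightMover⇒¬leftMover right)

  leftRank rightRank : ℕ → ℕ
  leftRank  = count leftMover?
  rightRank = count rightMover?

  leftRank-< : ∀ {a b} → LeftMover a → a < b → leftRank a < leftRank b
  leftRank-< left a<b = ≤-trans (≤-reflexive (sym (count-suc-yes leftMover? left))) (count-monoʳ leftMover? a<b)

  rightRank-< : ∀ {a b} → RightMover a → a < b → rightRank a < rightRank b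
  rightRank-< right a<b = ≤-trans (≤-reflexive (sym (count-suc-yes rightMover? right))) (count-monoʳ rightMover? a<b)

  -- The inversion (a, b) is undone in step  n + 1 + leftRank b − rightRank a,  stated without ∸.
  record Resolved (t a b : ℕ) : Set where
    constructor resolved
    field get : suc (leftRank b + n) < t + rightRank a

  record ResolvedAt (t a b : ℕ) : Set where
    constructor resolvedAt
    field get : suc (leftRank b + n) ≡ t + rightRank a

  resolved? : ∀ t a b → Dec (Resolved t a b)
  resolved? t a b = map′ resolved Resolved.get (_ <? _)

  resolvedAt? : ∀ t a b → Dec (ResolvedAt t a b)
  resolvedAt? t a b = map′ resolvedAt ResolvedAt.get (_ ≟ _)

  Swapped SwappedAt : ℕ → ℕ → ℕ → Set
  Swapped   t a b = Inversion a b × Resolved t a b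
  SwappedAt t a b = Inversion a b × ResolvedAt t a b

  swapped? : ∀ t a b → Dec (Swapped t a b)
  swapped? t a b = inversion? a b ×-dec resolved? t a b

  swapped-between : ∀ {t x y z} → x < y → y < z → z < n → Swapped t x z → Swapped t x y ⊎ Swapped t y z
  swapped-between {t} {x} {y} {z} x<y y<z z<n ((_ , _ , vz<vx) , resolved T<t) with <-cmp (v y) (v x)
  ... | tri< vy<vx _ _ =
    inj₁ (inv , resolved (≤-<-trans (s≤s (+-monoˡ-≤ n (<⇒≤ (leftRank-< (inversion⇒leftMover inv) y<z)))) T<t))
    where inv = x<y , <-trans y<z z<n , vy<vx
  ... | tri≈ _ vy≡vx _ = contradiction (v-injective (<-trans x<y (<-trans y<z z<n)) (<-trans y<z z<n) (sym vy≡vx)) (<⇒≢ x<y)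
  ... | tri> _ _ vx<vy =
    inj₂ ((y<z , z<n , <-trans vz<vx vx<vy) , resolved (<-≤-trans T<t (+-monoʳ-≤ t (<⇒≤ (rightRank-< x-right x<y)))))
    where x-right = inversion⇒rightMover (<-trans x<y y<z , z<n , vz<vx)

  swapped-chain : ∀ {t x y z} → Swapped t x y → Swapped t y z → ⊥
  swapped-chain ((x<y , _ , vy<vx) , _) ((y<z , z<n , vz<vy) , _) = no321 x<y y<z z<n vy<vx vz<vy

  infix 4 _≺[_]_
  _≺[_]_ : ℕ → ℕ → ℕ → Set
  a ≺[ t ] b = (a < b × ¬ Swapped t a b) ⊎ Swapped t b a

  _≺[_]?_ : ∀ a t b → Dec (a ≺[ t ] b)
  a ≺[ t ]? b = (a <? b ×-dec ¬? (swapped? t a b)) ⊎-dec swapped? t b a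

  ≺-irrefl : ∀ {t a} → ¬ a ≺[ t ] a
  ≺-irrefl (inj₁ (a<a , _))      = <-irrefl refl a<a
  ≺-irrefl (inj₂ ((a<a , _) , _)) = <-irrefl refl a<a

  ≺-asym : ∀ {t a b} → a ≺[ t ] b → ¬ b ≺[ t ] a
  ≺-asym (inj₁ (a<b , _))  (inj₁ (b<a , _))  = <-asym a<b b<a
  ≺-asym (inj₁ (_ , ¬sab)) (inj₂ sab)        = ¬sab sab
  ≺-asym (inj₂ sba)        (inj₁ (_ , ¬sba)) = ¬sba sba
  ≺-asym (inj₂ ((b<a , _) , _)) (inj₂ ((a<b , _) , _)) = <-asym a<b b<a

  ≺-trans : ∀ {t a b c} → a < n → b < n → c < n → a ≺[ t ] b → b ≺[ t ] c → a ≺[ t ] c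
  ≺-trans _ _ c<n (inj₁ (a<b , ¬sab)) (inj₁ (b<c , ¬sbc)) =
    inj₁ (<-trans a<b b<c , [ ¬sab , ¬sbc ]′ ∘ swapped-between a<b b<c c<n)
  ≺-trans {a = a} {c = c} _ b<n _ (inj₁ (a<b , ¬sab)) (inj₂ scb) with <-cmp a c
  ... | tri< a<c _ _ = inj₁ (a<c , λ sac → swapped-chain sac scb)
  ... | tri≈ _ refl _ = contradiction scb ¬sab
  ... | tri> _ _ c<a = inj₂ ([ id , (λ sab → contradiction sab ¬sab) ]′ (swapped-between c<a a<b b<n scb))
  ≺-trans {a = a} {c = c} a<n _ _ (inj₂ sba) (inj₁ (b<c , ¬sbc)) with <-cmp a c
  ... | tri< a<c _ _ = inj₁ (a<c , swapped-chain sba)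
  ... | tri≈ _ refl _ = contradiction sba ¬sbc
  ... | tri> _ _ c<a = inj₂ ([ (λ sbc → contradiction sbc ¬sbc) , id ]′ (swapped-between b<c c<a a<n sba))
  ≺-trans _ _ _ (inj₂ sba) (inj₂ scb) = ⊥-elim (swapped-chain scb sba)

  ≺-total : ∀ t {a b} → a ≢ b → a ≺[ t ] b ⊎ b ≺[ t ] a
  ≺-total t {a} {b} a≢b with <-cmp a b
  ... | tri≈ _ a≡b _ = contradiction a≡b a≢b
  ... | tri< a<b _ _ with swapped? t a b
  ...   | yes sab = inj₂ (inj₂ sab)
  ...   | no ¬sab = inj₁ (inj₁ (a<b , ¬sab))
  ≺-total t {a} {b} a≢b | tri> _ _ b<a with swapped? t b a
  ...   | yes sba = inj₁ (inj₂ sba)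
  ...   | no ¬sba = inj₂ (inj₁ (b<a , ¬sba))

  position : ℕ → ℕ → ℕ
  position t a = count (_≺[ t ]? a) n

  position-< : ∀ {t a b} → a < n → b < n → a ≺[ t ] b → position t a < position t b
  position-< {t} {a} {b} a<n b<n a≺b =
    count-mono-< (_≺[ t ]? a) (_≺[ t ]? b) n a<n ≺-irrefl a≺b (λ q<n q≺a → ≺-trans q<n a<n b<n q≺a a≺b)

  position<n : ∀ t {a} → a < n → position t a < n
  position<n t {a} a<n = count-< (_≺[ t ]? a) a<n ≺-irrefl

  position-injective : ∀ {t a b} → a < n → b < n → position t a ≡ position t b → a ≡ b
  position-injective {t} {a} {b} a<n b<n pa≡pb with a ≟ b
  ... | yes a≡b = a≡b
  ... | no  a≢b =
    contradiction pa≡pb ([ <⇒≢ ∘ position-< a<n b<n , (≢-sym ∘ <⇒≢) ∘ position-< b<n a<n ]′ (≺-total t a≢b))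

  resolved-suc : ∀ {t a b} → Resolved t a b → Resolved (suc t) a b
  resolved-suc (resolved T<t) = resolved (m<n⇒m<1+n T<t)

  resolvedAt⇒resolved-suc : ∀ {t a b} → ResolvedAt t a b → Resolved (suc t) a b
  resolvedAt⇒resolved-suc (resolvedAt T≡t) = resolved (s≤s (≤-reflexive T≡t))

  resolvedAt⇒¬resolved : ∀ {t a b} → ResolvedAt t a b → ¬ Resolved t a b
  resolvedAt⇒¬resolved (resolvedAt T≡t) (resolved T<t) = <-irrefl T≡t T<t

  resolved-suc⁻ : ∀ {t a b} → Resolved (suc t) a b → Resolved t a b ⊎ ResolvedAt t a b
  resolved-suc⁻ (resolved T<1+t) with m≤n⇒m<n∨m≡n (s≤s⁻¹ T<1+t)
  ... | inj₁ T<t = inj₁ (resolved T<t)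
  ... | inj₂ T≡t = inj₂ (resolvedAt T≡t)

  swapped-suc⁻ : ∀ {t a b} → ¬ SwappedAt t a b → Swapped (suc t) a b → Swapped t a b
  swapped-suc⁻ ¬sab (inv , r) = inv , [ id , (λ rAt → contradiction (inv , rAt) ¬sab) ]′ (resolved-suc⁻ r)

  ≺-suc : ∀ {t a b} → ¬ SwappedAt t a b → ¬ SwappedAt t b a → a ≺[ t ] b → a ≺[ suc t ] b
  ≺-suc ¬sab _ (inj₁ (a<b , ¬sab′)) = inj₁ (a<b , ¬sab′ ∘ swapped-suc⁻ ¬sab)
  ≺-suc _ _ (inj₂ (inv , r))         = inj₂ (inv , resolved-suc r)

  ≺-suc⁻ : ∀ {t a b} → ¬ SwappedAt t a b → ¬ SwappedAt t b a → a ≺[ suc t ] b → a ≺[ t ] b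
  ≺-suc⁻ _ _ (inj₁ (a<b , ¬sab′)) = inj₁ (a<b , ¬sab′ ∘ map₂ resolved-suc)
  ≺-suc⁻ _ ¬sba (inj₂ sba)        = inj₂ (swapped-suc⁻ ¬sba sba)

  swappedAt-unique-right : ∀ {t a b b′} → SwappedAt t a b → SwappedAt t a b′ → b ≡ b′
  swappedAt-unique-right {b = b} {b′} (inv , resolvedAt e) (inv′ , resolvedAt e′) with <-cmp b b′
  ... | tri< b<b′ _ _ =
    contradiction (+-cancelʳ-≡ n _ _ (suc-injective (trans e (sym e′)))) (<⇒≢ (leftRank-< (inversion⇒leftMover inv) b<b′))
  ... | tri≈ _ b≡b′ _ = b≡b′
  ... | tri> _ _ b′<b =
    contradiction (+-cancelʳ-≡ n _ _ (suc-injective (trans e′ (sym e)))) (<⇒≢ (leftRank-< (inversion⇒leftMover inv′) b′<b))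

  swappedAt-unique-left : ∀ {t a a′ b} → SwappedAt t a b → SwappedAt t a′ b → a ≡ a′
  swappedAt-unique-left {a = a} {a′} (inv , resolvedAt e) (inv′ , resolvedAt e′) with <-cmp a a′
  ... | tri< a<a′ _ _ =
    contradiction (+-cancelˡ-≡ _ _ _ (trans (sym e) e′)) (<⇒≢ (rightRank-< (inversion⇒rightMover inv) a<a′))
  ... | tri≈ _ a≡a′ _ = a≡a′
  ... | tri> _ _ a′<a =
    contradiction (+-cancelˡ-≡ _ _ _ (trans (sym e′) e)) (<⇒≢ (rightRank-< (inversion⇒rightMover inv′) a′<a))

  swappedAt⇒≺ : ∀ {t a b} → SwappedAt t a b → a ≺[ t ] b
  swappedAt⇒≺ ((a<b , _) , rAt) = inj₁ (a<b , resolvedAt⇒¬resolved rAt ∘ proj₂)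

  swappedAt⇒≻-suc : ∀ {t a b} → SwappedAt t a b → b ≺[ suc t ] a
  swappedAt⇒≻-suc (inv , rAt) = inj₂ (inv , resolvedAt⇒resolved-suc rAt)

  inversion-¬after : ∀ {a b q} → Inversion a b → ¬ Inversion q a
  inversion-¬after inv = rightMover⇒¬leftMover (inversion⇒rightMover inv) ∘ inversion⇒leftMover

  inversion-¬before : ∀ {a b q} → Inversion a b → ¬ Inversion b q
  inversion-¬before inv inv′ = rightMover⇒¬leftMover (inversion⇒rightMover inv′) (inversion⇒leftMover inv)

  MovesRightAt MovesLeftAt : ℕ → ℕ → Set
  MovesRightAt t a = ∃ λ b → b < n × SwappedAt t a b
  MovesLeftAt  t b = ∃ λ a → a < n × SwappedAt t a b

  movesRightAt? : ∀ t → Decidable (MovesRightAt t)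
  movesRightAt? t a = anyUpTo? (λ b → inversion? a b ×-dec resolvedAt? t a b) n

  movesLeftAt? : ∀ t → Decidable (MovesLeftAt t)
  movesLeftAt? t b = anyUpTo? (λ a → inversion? a b ×-dec resolvedAt? t a b) n

  position-suc-right : ∀ {t a} → MovesRightAt t a → position (suc t) a ≡ suc (position t a)
  position-suc-right {t} {a} (b , b<n , sab@(inv , _)) =
    count-insert (_≺[ t ]? a) (_≺[ suc t ]? a) n b<n (≺-asym (swappedAt⇒≺ sab)) (swappedAt⇒≻-suc sab)
      (λ _ q≢b → ≺-suc (inversion-¬after inv ∘ proj₁) (q≢b ∘ sym ∘ swappedAt-unique-right sab))
      (λ _ q≢b → ≺-suc⁻ (inversion-¬after inv ∘ proj₁) (q≢b ∘ sym ∘ swappedAt-unique-right sab))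

  position-suc-left : ∀ {t b} → MovesLeftAt t b → position t b ≡ suc (position (suc t) b)
  position-suc-left {t} {b} (a , a<n , sab@(inv , _)) =
    count-insert (_≺[ suc t ]? b) (_≺[ t ]? b) n a<n (≺-asym (swappedAt⇒≻-suc sab)) (swappedAt⇒≺ sab)
      (λ _ q≢a → ≺-suc⁻ (q≢a ∘ sym ∘ swappedAt-unique-left sab) (inversion-¬before inv ∘ proj₁))
      (λ _ q≢a → ≺-suc (q≢a ∘ sym ∘ swappedAt-unique-left sab) (inversion-¬before inv ∘ proj₁))

  position-suc-stay : ∀ {t a} → ¬ MovesRightAt t a → ¬ MovesLeftAt t a → position (suc t) a ≡ position t a
  position-suc-stay {t} {a} ¬right ¬left =
    count-cong (_≺[ suc t ]? a) (_≺[ t ]? a) n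
      (λ q<n → ≺-suc⁻ (λ sqa → ¬left (_ , q<n , sqa)) (λ saq → ¬right (_ , q<n , saq)))
      (λ q<n → ≺-suc (λ sqa → ¬left (_ , q<n , sqa)) (λ saq → ¬right (_ , q<n , saq)))

  -- the partners of an exchange are neighbours: anything between them would stay between them
  swappedAt⇒adjacent : ∀ {t a b} → a < n → SwappedAt t a b → position t b ≡ suc (position t a)
  swappedAt⇒adjacent {t} {a} {b} a<n sab@(inv@(_ , b<n , _) , _) =
    count-insert (_≺[ t ]? a) (_≺[ t ]? b) n a<n ≺-irrefl a≺b
      (λ q<n _ q≺a → ≺-trans q<n a<n b<n q≺a a≺b) q≺b⇒q≺a
    where
    a≺b = swappedAt⇒≺ sab

    q≺b⇒q≺a : ∀ {q} → q < n → q ≢ a → q ≺[ t ] b → q ≺[ t ] a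
    q≺b⇒q≺a {q} q<n q≢a q≺b with ≺-total t q≢a | q ≟ b
    ... | inj₁ q≺a | _        = q≺a
    ... | inj₂ _   | yes refl = contradiction q≺b ≺-irrefl
    ... | inj₂ a≺q | no q≢b   = contradiction (swappedAt⇒≻-suc sab) (≺-asym (≺-trans a<n q<n b<n
          (≺-suc (q≢b ∘ sym ∘ swappedAt-unique-right sab) (inversion-¬after inv ∘ proj₁) a≺q)
          (≺-suc (q≢a ∘ sym ∘ swappedAt-unique-left sab) (inversion-¬before inv ∘ proj₁) q≺b)))

  movesRightAt-contiguous : ∀ {t₁ t t₂ a} → t₁ < t → t < t₂ → MovesRightAt t₁ a → MovesRightAt t₂ a → MovesRightAt t a
  movesRightAt-contiguous {t₁} {t} {t₂} {a} t₁<t t<t₂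
    (b₁ , _ , inv₁@(a<b₁ , _) , resolvedAt e₁) (b₂ , b₂<n , inv₂ , resolvedAt e₂) =
    partner (count-ivt leftMover? (subst (_≤ c) (sym (count-suc-yes leftMover? (inversion⇒leftMover inv₁))) b₁<c) c<b₂)
    where
    T = t + rightRank a
    c = T ∸ suc n

    T₁<T : suc (leftRank b₁ + n) < T
    T₁<T = subst (_< T) (sym e₁) (+-monoˡ-< _ t₁<t)

    1+c+n≡T : suc (c + n) ≡ T
    1+c+n≡T = trans (sym (+-suc c n)) (m∸n+n≡m (≤-trans (s≤s (m≤n+m n _)) (<⇒≤ T₁<T)))

    b₁<c : leftRank b₁ < c
    b₁<c = +-cancelʳ-< n _ _ (s≤s⁻¹ (subst (suc (leftRank b₁ + n) <_) (sym 1+c+n≡T) T₁<T))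

    c<b₂ : c < leftRank b₂
    c<b₂ = +-cancelʳ-< n _ _ (s≤s⁻¹ (subst₂ _<_ (sym 1+c+n≡T) (sym e₂) (+-monoˡ-< _ t<t₂)))

    partner : (∃ λ j → suc b₁ ≤ j × j < b₂ × LeftMover j × leftRank j ≡ c) → MovesRightAt t a
    partner (j , b₁<j , j<b₂ , left , rank≡c) =
      j , j<n , (<-trans a<b₁ b₁<j , j<n , <-trans (leftMover-< left j<b₂ b₂<n) (proj₂ (proj₂ inv₂))) ,
      resolvedAt (trans (cong (λ r → suc (r + n)) rank≡c) 1+c+n≡T)
      where j<n = <-trans j<b₂ b₂<n

  movesLeftAt-contiguous : ∀ {t₁ t t₂ b} → t₁ < t → t < t₂ → MovesLeftAt t₁ b → MovesLeftAt t₂ b → MovesLeftAt t b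
  movesLeftAt-contiguous {t₁} {t} {t₂} {b} t₁<t t<t₂
    (a₁ , a₁<n , inv₁@(a₁<b , b<n , _) , resolvedAt e₁) (a₂ , _ , inv₂ , resolvedAt e₂) =
    partner (count-ivt rightMover? (subst (_≤ c) (sym (count-suc-yes rightMover? (inversion⇒rightMover inv₂))) a₂<c) c<a₁)
    where
    S = suc (leftRank b + n)
    c = S ∸ t

    t<S : t < S
    t<S = <-≤-trans t<t₂ (subst (t₂ ≤_) (sym e₂) (m≤m+n t₂ _))

    t+c≡S : t + c ≡ S
    t+c≡S = m+[n∸m]≡n (<⇒≤ t<S)

    a₂<c : rightRank a₂ < c
    a₂<c = +-cancelˡ-< t _ _ (subst (t + rightRank a₂ <_) (trans (sym e₂) (sym t+c≡S)) (+-monoˡ-< _ t<t₂))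

    c<a₁ : c < rightRank a₁
    c<a₁ = +-cancelˡ-< t _ _ (subst (_< t + rightRank a₁) (trans (sym e₁) (sym t+c≡S)) (+-monoˡ-< _ t₁<t))

    partner : (∃ λ j → suc a₂ ≤ j × j < a₁ × RightMover j × rightRank j ≡ c) → MovesLeftAt t b
    partner (j , a₂<j , j<a₁ , right , rank≡c) =
      j , j<n , (<-trans j<a₁ a₁<b , b<n , <-trans (proj₂ (proj₂ inv₂)) (rightMover-< right a₂<j j<n)) ,
      resolvedAt (trans (sym t+c≡S) (cong (t +_) (sym rank≡c)))
      where j<n = <-trans j<a₁ a₁<n

  ¬swapped-early : ∀ {t a b} → t ≤ 1 → ¬ Swapped t a b
  ¬swapped-early {t} {a} {b} t≤1 ((a<b , b<n , _) , resolved T<t) = <⇒≱ (begin-strict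
    suc (leftRank b + n) <⟨ T<t ⟩
    t + rightRank a      ≤⟨ +-mono-≤ t≤1 (≤-trans (count-≤ rightMover? a) (<⇒≤ (<-trans a<b b<n))) ⟩
    suc n                ∎) (s≤s (m≤n+m n _))
    where open ≤-Reasoning

  position-early : ∀ {t a} → t ≤ 1 → a ≤ n → position t a ≡ a
  position-early {t} {a} t≤1 a≤n = begin
    position t a     ≡⟨ count-cong (_≺[ t ]? a) (_<? a) n (λ _ → [ proj₁ , ⊥-elim ∘ ¬swapped-early t≤1 ]′)
                                                           (λ _ q<a → inj₁ (q<a , ¬swapped-early t≤1)) ⟩
    count (_<? a) n  ≡⟨ count-<? a n ⟩
    n ⊓ a            ≡⟨ m≥n⇒m⊓n≡n a≤n ⟩
    a                ∎
    where open ≡-Reasoning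

  -- every inversion is resolved before this time
  horizon : ℕ
  horizon = suc (suc (n + n))

  leftRank+n<horizon : ∀ {b} → b ≤ n → suc (leftRank b + n) < horizon
  leftRank+n<horizon b≤n = s≤s (s≤s (+-monoˡ-≤ n (≤-trans (count-≤ leftMover? _) b≤n)))

  swapped-late : ∀ {t a b} → horizon ≤ t → Inversion a b → Swapped t a b
  swapped-late {t} horizon≤t inv@(_ , b<n , _) =
    inv , resolved (<-≤-trans (leftRank+n<horizon (<⇒≤ b<n)) (≤-trans horizon≤t (m≤m+n t _)))

  ¬resolvedAt-late : ∀ {t a b} → horizon ≤ t → b ≤ n → ¬ ResolvedAt t a b
  ¬resolvedAt-late {t} horizon≤t b≤n (resolvedAt T≡t) =
    <⇒≢ (<-≤-trans (leftRank+n<horizon b≤n) (≤-trans horizon≤t (m≤m+n t _))) T≡t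

  position-late-stable : ∀ {t a} → horizon ≤ t → a < n → position (suc t) a ≡ position t a
  position-late-stable horizon≤t a<n = position-suc-stay
    (λ (_ , _ , (_ , b<n , _) , rAt) → ¬resolvedAt-late horizon≤t (<⇒≤ b<n) rAt)
    (λ (_ , _ , _ , rAt) → ¬resolvedAt-late horizon≤t (<⇒≤ a<n) rAt)

  ≺-late : ∀ {t q a} → horizon ≤ t → q < n → a < n → v q < v a → q ≺[ t ] a
  ≺-late {t} {q} {a} horizon≤t q<n a<n vq<va with <-cmp q a
  ... | tri< q<a _ _  = inj₁ (q<a , λ ((_ , _ , va<vq) , _) → <-asym vq<va va<vq)
  ... | tri≈ _ refl _ = contradiction vq<va (<-irrefl refl)
  ... | tri> _ _ a<q  = inj₂ (swapped-late horizon≤t (a<q , q<n , vq<va))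

  SwapAt : ℕ → ℕ → Set
  SwapAt t s = ∃ λ a → a < n × position t a ≡ s × MovesRightAt t a

  swapAt? : ∀ t → Decidable (SwapAt t)
  swapAt? t s = anyUpTo? (λ a → position t a ≟ s ×-dec movesRightAt? t a) n

  swapAt-isolated : ∀ {t s} → SwapAt t s → ¬ SwapAt t (suc s)
  swapAt-isolated (a , a<n , refl , b , b<n , sab@(inv , _)) (a′ , a′<n , pa′≡1+pa , _ , _ , (inv′ , _))
    with position-injective b<n a′<n (trans (swappedAt⇒adjacent a<n sab) (sym pa′≡1+pa))
  ... | refl = inversion-¬before inv inv′

  swapAt-bound : ∀ {t s} → SwapAt t s → suc s < n
  swapAt-bound (a , a<n , refl , b , b<n , sab) = subst (_< n) (swappedAt⇒adjacent a<n sab) (position<n _ b<n)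

  swaps : ℕ → List ℕ
  swaps t = positionsWhere (swapAt? t) n

  swaps-farApart : ∀ t → AllPairs FarApart (swaps t)
  swaps-farApart t = positionsWhere-farApart (swapAt? t) swapAt-isolated n

  swaps-bound : ∀ t → All (λ s → suc s < n) (swaps t)
  swaps-bound t = All.tabulate (swapAt-bound ∘ proj₂ ∘ ∈-positionsWhere⁻ (swapAt? t) {n})

  applySwaps-moveRight : ∀ {t a} → a < n → MovesRightAt t a → applySwaps (swaps t) (position (suc t) a) ≡ position t a
  applySwaps-moveRight {t} {a} a<n right = begin
    applySwaps (swaps t) (position (suc t) a)  ≡⟨ cong (applySwaps (swaps t)) (position-suc-right right) ⟩
    applySwaps (swaps t) (suc (position t a))  ≡⟨ applySwaps-suc-∈ (swaps-farApart t) swapped ⟩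
    position t a                               ∎
    where
    open ≡-Reasoning
    swapped = ∈-positionsWhere⁺ (swapAt? t) (position<n t a<n) (a , a<n , refl , right)

  applySwaps-moveLeft : ∀ {t a} → a < n → MovesLeftAt t a → applySwaps (swaps t) (position (suc t) a) ≡ position t a
  applySwaps-moveLeft {t} {a} a<n left@(a₀ , a₀<n , sa₀a) = begin
    applySwaps (swaps t) (position (suc t) a) ≡⟨ cong (applySwaps (swaps t)) partner ⟩
    applySwaps (swaps t) (position t a₀)      ≡⟨ applySwaps-∈ (swaps-farApart t) swapped ⟩
    suc (position t a₀)                       ≡⟨ swappedAt⇒adjacent a₀<n sa₀a ⟨
    position t a                              ∎
    where
    open ≡-Reasoning
    swapped = ∈-positionsWhere⁺ (swapAt? t) (position<n t a₀<n) (a₀ , a₀<n , refl , a , a<n , sa₀a)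
    partner : position (suc t) a ≡ position t a₀
    partner = suc-injective (trans (sym (position-suc-left left)) (swappedAt⇒adjacent a₀<n sa₀a))

  applySwaps-stay : ∀ {t a} → a < n → ¬ MovesRightAt t a → ¬ MovesLeftAt t a →
                    applySwaps (swaps t) (position (suc t) a) ≡ position t a
  applySwaps-stay {t} {a} a<n ¬right ¬left =
    trans (cong (applySwaps (swaps t)) (position-suc-stay ¬right ¬left)) (applySwaps-∉ not-source not-target)
    where
    not-source : position t a ∉ swaps t
    not-source p∈ with ∈-positionsWhere⁻ (swapAt? t) {n} p∈
    ... | _ , a′ , a′<n , pa′≡pa , right = ¬right (subst (MovesRightAt t) (position-injective a′<n a<n pa′≡pa) right)

    not-target : ∀ {s} → position t a ≡ suc s → s ∉ swaps t
    not-target pa≡1+s s∈ with ∈-positionsWhere⁻ (swapAt? t) {n} s∈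
    ... | _ , a′ , a′<n , pa′≡s , b , b<n , sa′b =
      ¬left (a′ , a′<n , subst (SwappedAt t a′) (position-injective b<n a<n pb≡pa) sa′b)
      where pb≡pa = trans (swappedAt⇒adjacent a′<n sa′b) (trans (cong suc pa′≡s) (sym pa≡1+s))

  applySwaps-position : ∀ {t a} → a < n → applySwaps (swaps t) (position (suc t) a) ≡ position t a
  applySwaps-position {t} {a} a<n = by-cases (movesRightAt? t a) (movesLeftAt? t a)
    where
    by-cases : Dec (MovesRightAt t a) → Dec (MovesLeftAt t a) → applySwaps (swaps t) (position (suc t) a) ≡ position t a
    by-cases (yes right) _          = applySwaps-moveRight a<n right
    by-cases (no _)      (yes left) = applySwaps-moveLeft a<n left
    by-cases (no ¬right) (no ¬left) = applySwaps-stay a<n ¬right ¬left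

  direction : ℕ → ℕ → ℤ
  direction a t = ℤ.+ position (suc t) a ℤ.- ℤ.+ position t a

  direction-≡ : ∀ {t a p q} → position (suc t) a ≡ p → position t a ≡ q → direction a t ≡ ℤ.+ p ℤ.- ℤ.+ q
  direction-≡ = cong₂ λ p q → ℤ.+ p ℤ.- ℤ.+ q

  direction-start : ∀ {a} → a < n → direction a 0 ≡ 0ℤ
  direction-start {a} a<n =
    trans (direction-≡ (position-early (s≤s z≤n) (<⇒≤ a<n)) (position-early z≤n (<⇒≤ a<n))) (ℤ.+-inverseʳ (ℤ.+ a))

  direction-right : ∀ {t a} → MovesRightAt t a → direction a t ≡ 1ℤ
  direction-right {t} {a} right = trans (direction-≡ (position-suc-right right) refl) (+[1+m]-+m≡1 (position t a))

  direction-left : ∀ {t a} → MovesLeftAt t a → direction a t ≡ -1ℤ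
  direction-left {t} {a} left = trans (direction-≡ refl (position-suc-left left)) (+m-+[1+m]≡-1 (position (suc t) a))

  direction-stay : ∀ {t a} → ¬ MovesRightAt t a → ¬ MovesLeftAt t a → direction a t ≡ 0ℤ
  direction-stay {t} {a} ¬right ¬left = trans (direction-≡ (position-suc-stay ¬right ¬left) refl) (ℤ.+-inverseʳ (ℤ.+ position t a))

  variation-direction : ∀ {a d} (Moves : ℕ → Set) → Decidable Moves → ∣ d ∣ ≡ 1 → a < n →
                        (∀ {t} → Moves t → direction a t ≡ d) → (∀ {t} → ¬ Moves t → direction a t ≡ 0ℤ) →
                        (∀ {t₁ t t₂} → t₁ < t → t < t₂ → Moves t₁ → Moves t₂ → Moves t) →
                        ∀ N → variation (direction a) N ≤ 2
  variation-direction {a} {d} Moves moves? ∣d∣≡1 a<n moving resting contiguous =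
    variation≤2 (direction a) ∣d∣≡1 (direction-start a<n) values
      (λ t₁<t t<t₂ e₁ e₂ → moving (contiguous t₁<t t<t₂ (moves e₁) (moves e₂)))
    where
    values : ∀ t → direction a t ≡ 0ℤ ⊎ direction a t ≡ d
    values t with moves? t
    ... | yes m = inj₂ (moving m)
    ... | no ¬m = inj₁ (resting ¬m)

    moves : ∀ {t} → direction a t ≡ d → Moves t
    moves {t} e with moves? t
    ... | yes m = m
    ... | no ¬m = contradiction (trans (cong ∣_∣ (trans (sym (resting ¬m)) e)) ∣d∣≡1) λ ()

  variation-direction≤2 : ∀ {a} → a < n → ∀ N → variation (direction a) N ≤ 2
  variation-direction≤2 {a} a<n = by-cases (leftMover? a)
    where
    by-cases : Dec (LeftMover a) → ∀ N → variation (direction a) N ≤ 2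
    by-cases (yes left) = variation-direction (λ t → MovesLeftAt t a) (λ t → movesLeftAt? t a) refl a<n direction-left
      (direction-stay (λ (_ , _ , sab) → rightMover⇒¬leftMover (inversion⇒rightMover (proj₁ sab)) left))
      movesLeftAt-contiguous
    by-cases (no ¬left) = variation-direction (λ t → MovesRightAt t a) (λ t → movesRightAt? t a) refl a<n direction-right
      (λ ¬right → direction-stay ¬right (λ (_ , _ , sba) → ¬left (inversion⇒leftMover (proj₁ sba))))
      movesRightAt-contiguous

injective⇒surjective : ∀ {n} {f : Fin n → Fin n} → Injective _≡_ _≡_ f → ∀ p → ∃ λ a → f a ≡ p
injective⇒surjective {suc k} {f} f-injective p with any? (λ a → f a Fin.≟ p)
... | yes hit = hit
... | no miss = contradiction (injective⇒≤ avoid-p-injective) 1+n≰n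
  where
  p∉image : ∀ a → p ≢ f a
  p∉image a p≡fa = miss (a , sym p≡fa)

  avoid-p : Fin (suc k) → Fin k
  avoid-p a = Fin.punchOut (p∉image a)

  avoid-p-injective : Injective _≡_ _≡_ avoid-p
  avoid-p-injective {a} {b} = f-injective ∘ punchOut-injective (p∉image a) (p∉image b)

strictMono⇒id : ∀ {n} (h : ℕ → ℕ) → (∀ {x y} → x < y → y < n → h x < h y) → (∀ {y} → y < n → h y < n) →
                ∀ {y} → y < n → h y ≡ y
strictMono⇒id {n} h mono bounded {y} y<n = ≤-antisym h-≤ (≤h y y<n)
  where
  ≤h : ∀ y → y < n → y ≤ h y
  ≤h zero    _     = z≤n
  ≤h (suc y) 1+y<n = <-≤-trans (s≤s (≤h y (<-trans (n<1+n y) 1+y<n))) (mono (n<1+n y) 1+y<n)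

  room : ∀ d {y} → y + d < n → h y + d < n
  room zero {y} y<n rewrite +-identityʳ y | +-identityʳ (h y) = bounded y<n
  room (suc d) {y} y+1+d<n rewrite +-suc (h y) d | +-suc y d =
    ≤-<-trans (+-monoˡ-≤ d (mono (n<1+n y) (≤-<-trans (m≤m+n (suc y) d) y+1+d<n))) (room d y+1+d<n)

  h-≤ : h y ≤ y
  h-≤ with m≤n⇒∃[o]m+o≡n y<n
  ... | d , 1+y+d≡n =
    s≤s⁻¹ (+-cancelʳ-≤ d _ _ (subst (h y + d <_) (sym 1+y+d≡n) (room d (subst (y + d <_) 1+y+d≡n ≤-refl))))

injective⇒permutation : ∀ {n} (f : Fin n → Fin n) → Injective _≡_ _≡_ f → Permutation′ n
injective⇒permutation f f-injective =
  Perm.permutation (proj₁ ∘ surjective) f (λ a → f-injective (proj₂ (surjective (f a)))) (proj₂ ∘ surjective)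
  where surjective = injective⇒surjective f-injective

-- arguments q ≥ n are mapped to themselves; no lemma below depends on that choice
onℕ : ∀ {n} → (Fin n → Fin n) → ℕ → ℕ
onℕ {n} f q with q <? n
... | yes q<n = toℕ (f (fromℕ< q<n))
... | no  _   = q

onℕ-toℕ : ∀ {n} (f : Fin n → Fin n) x → onℕ f (toℕ x) ≡ toℕ (f x)
onℕ-toℕ {n} f x with toℕ x <? n
... | yes x<n = cong (toℕ ∘ f) (fromℕ<-toℕ x x<n)
... | no  x≮n = contradiction (toℕ<n x) x≮n

onℕ-fromℕ< : ∀ {n q} (f : Fin n → Fin n) (q<n : q < n) → onℕ f q ≡ toℕ (f (fromℕ< q<n))
onℕ-fromℕ< f q<n = trans (cong (onℕ f) (sym (toℕ-fromℕ< q<n))) (onℕ-toℕ f (fromℕ< q<n))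

onℕ-< : ∀ {n q} (f : Fin n → Fin n) → q < n → onℕ f q < n
onℕ-< f q<n = subst (_< _) (sym (onℕ-fromℕ< f q<n)) (toℕ<n _)

onℕ-injective : ∀ {n a b} {f : Fin n → Fin n} → Injective _≡_ _≡_ f → a < n → b < n → onℕ f a ≡ onℕ f b → a ≡ b
onℕ-injective {f = f} f-injective a<n b<n fa≡fb =
  trans (sym (toℕ-fromℕ< a<n))
        (trans (cong toℕ (f-injective (toℕ-injective (trans (sym (onℕ-fromℕ< f a<n)) (trans fa≡fb (onℕ-fromℕ< f b<n))))))
               (toℕ-fromℕ< b<n))

onℕ-inverse : ∀ {n y} (π : Permutation′ n) → y < n → onℕ (π ⟨$⟩ʳ_) (onℕ (π ⟨$⟩ˡ_) y) ≡ y
onℕ-inverse {y = y} π y<n = begin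
  onℕ (π ⟨$⟩ʳ_) (onℕ (π ⟨$⟩ˡ_) y)          ≡⟨ cong (onℕ (π ⟨$⟩ʳ_)) (onℕ-fromℕ< (π ⟨$⟩ˡ_) y<n) ⟩
  onℕ (π ⟨$⟩ʳ_) (toℕ (π ⟨$⟩ˡ fromℕ< y<n))  ≡⟨ onℕ-toℕ (π ⟨$⟩ʳ_) _ ⟩
  toℕ (π ⟨$⟩ʳ (π ⟨$⟩ˡ fromℕ< y<n))         ≡⟨ cong toℕ (inverseʳ π) ⟩
  toℕ (fromℕ< y<n)                        ≡⟨ toℕ-fromℕ< y<n ⟩
  y                                       ∎
  where open ≡-Reasoning

⟨$⟩ʳ-injective : ∀ {n} (π : Permutation′ n) → Injective _≡_ _≡_ (π ⟨$⟩ʳ_)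
⟨$⟩ʳ-injective π πx≡πy = trans (sym (inverseˡ π)) (trans (cong (π ⟨$⟩ˡ_) πx≡πy) (inverseˡ π))

Descending3 : ∀ {n} → Permutation′ n → Set
Descending3 {n} π = ∃₂ λ (i j : Fin n) → ∃ λ k →
  toℕ i < toℕ j × toℕ j < toℕ k × toℕ (π ⟨$⟩ʳ k) < toℕ (π ⟨$⟩ʳ j) × toℕ (π ⟨$⟩ʳ j) < toℕ (π ⟨$⟩ʳ i)

Fin3-pairs : ∀ {P : Fin 3 → Fin 3 → Set} → P 0F 1F → P 0F 2F → P 1F 2F → ∀ r s → toℕ r < toℕ s → P r s
Fin3-pairs p₀₁ _   _   0F 1F _ = p₀₁
Fin3-pairs _   p₀₂ _   0F 2F _ = p₀₂
Fin3-pairs _   _   p₁₂ 1F 2F _ = p₁₂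
Fin3-pairs _ _ _ 0F 0F ()
Fin3-pairs _ _ _ 1F 0F ()
Fin3-pairs _ _ _ 1F 1F (s≤s ())
Fin3-pairs _ _ _ 2F 0F ()
Fin3-pairs _ _ _ 2F 1F (s≤s ())
Fin3-pairs _ _ _ 2F 2F (s≤s (s≤s ()))

descending⇒contains321 : ∀ {n} {π : Permutation′ n} → Descending3 π → Contains π pattern321
descending⇒contains321 {π = π} (i , j , k , i<j , j<k , πk<πj , πj<πi) =
  embed , Fin3-pairs i<j (<-trans i<j j<k) j<k ,
  Fin3-pairs (against πj<πi , λ { (s≤s ()) }) (against (<-trans πk<πj πj<πi) , λ ()) (against πk<πj , λ ())
  where
  embed : Fin 3 → Fin _
  embed 0F = i
  embed 1F = j
  embed 2F = k
  against : ∀ {x y} {A : Set} → y < x → x < y → A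
  against y<x x<y = contradiction x<y (<-asym y<x)

contains321⇒descending : ∀ {n} {π : Permutation′ n} → Contains π pattern321 → Descending3 π
contains321⇒descending {π = π} (embed , mono , pat) =
  embed 0F , embed 1F , embed 2F , i<j , j<k , descent j<k ((λ ()) ∘ proj₁ (pat 1F 2F (s≤s (s≤s z≤n)))) ,
  descent i<j ((λ { (s≤s ()) }) ∘ proj₁ (pat 0F 1F (s≤s z≤n)))
  where
  i<j = mono 0F 1F (s≤s z≤n)
  j<k = mono 1F 2F (s≤s (s≤s z≤n))
  descent : ∀ {x y} → toℕ x < toℕ y → ¬ toℕ (π ⟨$⟩ʳ x) < toℕ (π ⟨$⟩ʳ y) →
            toℕ (π ⟨$⟩ʳ y) < toℕ (π ⟨$⟩ʳ x)
  descent x<y πx≮πy =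
    ≤∧≢⇒< (≮⇒≥ πx≮πy) λ πy≡πx → <⇒≢ x<y (cong toℕ (⟨$⟩ʳ-injective π (toℕ-injective (sym πy≡πx))))

module DirectTangle {n} (π : Permutation′ n) (avoids : Avoids321 π) where

  v : ℕ → ℕ
  v = onℕ (π ⟨$⟩ʳ_)

  no321 : ∀ {a b c} → a < b → b < c → c < n → v b < v a → v c < v b → ⊥
  no321 {a} {b} {c} a<b b<c c<n vb<va vc<vb = avoids (descending⇒contains321 {π = π}
    (fromℕ< a<n , fromℕ< b<n , fromℕ< c<n ,
     subst₂ _<_ (sym (toℕ-fromℕ< a<n)) (sym (toℕ-fromℕ< b<n)) a<b ,
     subst₂ _<_ (sym (toℕ-fromℕ< b<n)) (sym (toℕ-fromℕ< c<n)) b<c ,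
     subst₂ _<_ (onℕ-fromℕ< (π ⟨$⟩ʳ_) c<n) (onℕ-fromℕ< (π ⟨$⟩ʳ_) b<n) vc<vb ,
     subst₂ _<_ (onℕ-fromℕ< (π ⟨$⟩ʳ_) b<n) (onℕ-fromℕ< (π ⟨$⟩ʳ_) a<n) vb<va))
    where
    b<n = <-trans b<c c<n
    a<n = <-trans a<b b<n

  open Schedule n v (onℕ-injective (⟨$⟩ʳ-injective π)) no321

  positionFin : ℕ → Fin n → Fin n
  positionFin t a = fromℕ< (position<n t (toℕ<n a))

  positionFin-injective : ∀ t → Injective _≡_ _≡_ (positionFin t)
  positionFin-injective t {a} {b} e = toℕ-injective (position-injective (toℕ<n a) (toℕ<n b)
    (trans (sym (toℕ-fromℕ< (position<n t (toℕ<n a)))) (trans (cong toℕ e) (toℕ-fromℕ< (position<n t (toℕ<n b))))))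

  -- arrangement t ⟨$⟩ʳ p is the initial position of the element at position p after t steps
  arrangement : ℕ → Permutation′ n
  arrangement t = injective⇒permutation (positionFin t) (positionFin-injective t)

  position-arrangement : ∀ t p → position t (toℕ (arrangement t ⟨$⟩ʳ p)) ≡ toℕ p
  position-arrangement t p =
    trans (sym (toℕ-fromℕ< (position<n t (toℕ<n (arrangement t ⟨$⟩ʳ p))))) (cong toℕ (inverseˡ (arrangement t)))

  arrangement-at : ∀ {t a p} → position t (toℕ a) ≡ toℕ p → arrangement t ⟨$⟩ʳ p ≡ a
  arrangement-at {t} {a} pa≡p =
    trans (cong (arrangement t ⟨$⟩ʳ_) (toℕ-injective (trans (sym pa≡p) (sym (toℕ-fromℕ< (position<n t (toℕ<n a)))))))
          (inverseʳ (arrangement t))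

  arrangement-early : ∀ {t} → t ≤ 1 → ∀ p → arrangement t ⟨$⟩ʳ p ≡ p
  arrangement-early {t} t≤1 p = arrangement-at {t} {p} {p} (position-early t≤1 (<⇒≤ (toℕ<n p)))

  position-final : ∀ {y} → y < n → position (suc horizon) (onℕ (π ⟨$⟩ˡ_) y) ≡ y
  position-final = strictMono⇒id (λ y → position (suc horizon) (w y))
    (λ x<y y<n → position-< (w<n (<-trans x<y y<n)) (w<n y<n)
       (≺-late (n≤1+n horizon) (w<n (<-trans x<y y<n)) (w<n y<n)
          (subst₂ _<_ (sym (onℕ-inverse π (<-trans x<y y<n))) (sym (onℕ-inverse π y<n)) x<y)))
    (position<n (suc horizon) ∘ w<n)
    where
    w = onℕ (π ⟨$⟩ˡ_)
    w<n : ∀ {y} → y < n → w y < n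
    w<n = onℕ-< (π ⟨$⟩ˡ_)

  tangle : Tangle π
  tangle = record
    { m        = suc horizon
    ; τ        = τ
    ; m≥1      = s≤s z≤n
    ; start    = λ p → cong (π ⟨$⟩ʳ_) (arrangement-early z≤n p)
    ; finish   = λ x → trans (cong (π ⟨$⟩ʳ_) (arrangement-at (final x))) (inverseʳ π)
    ; adjacent = λ t _ → swaps t , swaps-bound t , swaps-farApart t , follows-swaps t
    ; repFirst = λ p → cong (π ⟨$⟩ʳ_) (trans (arrangement-early z≤n p) (sym (arrangement-early (s≤s z≤n) p)))
    ; repLast  = λ p → cong (π ⟨$⟩ʳ_) (arrangement-at
        (trans (sym (position-late-stable ≤-refl (toℕ<n _))) (position-arrangement (suc horizon) p)))
    }
    where
    τ : ℕ → Permutation′ n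
    τ t = arrangement t ∘ₚ π

    final : ∀ x → position (suc horizon) (toℕ (π ⟨$⟩ˡ x)) ≡ toℕ x
    final x = trans (cong (position (suc horizon)) (sym (onℕ-toℕ (π ⟨$⟩ˡ_) x))) (position-final (toℕ<n x))

    follows-swaps : ∀ t p q → toℕ q ≡ applySwaps (swaps t) (toℕ p) → τ (suc t) ⟨$⟩ʳ p ≡ τ t ⟨$⟩ʳ q
    follows-swaps t p q q≡swapped-p = cong (π ⟨$⟩ʳ_) (sym (arrangement-at (begin
      position t (toℕ a)                                ≡⟨ applySwaps-position (toℕ<n a) ⟨
      applySwaps (swaps t) (position (suc t) (toℕ a))   ≡⟨ cong (applySwaps (swaps t)) (position-arrangement (suc t) p) ⟩
      applySwaps (swaps t) (toℕ p)                      ≡⟨ q≡swapped-p ⟨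
      toℕ q                                             ∎)))
      where
      open ≡-Reasoning
      a = arrangement (suc t) ⟨$⟩ʳ p

  corners≡variation : ∀ x → corners tangle x ≡ variation (direction (toℕ (π ⟨$⟩ˡ x))) horizon
  corners≡variation x = variation-cong (λ t → cong₂ (λ p q → ℤ.+ p ℤ.- ℤ.+ q)
    (toℕ-fromℕ< (position<n (suc t) (toℕ<n (π ⟨$⟩ˡ x)))) (toℕ-fromℕ< (position<n t (toℕ<n (π ⟨$⟩ˡ x))))) horizon

  hasDirectTangle : HasDirectTangle π
  hasDirectTangle = tangle , λ x → subst (_≤ 2) (sym (corners≡variation x)) (variation-direction≤2 (toℕ<n _) horizon)

≈⇒≈ˡ : ∀ {n} {ρ ρ′ : Permutation′ n} → ρ Perm.≈ ρ′ → ∀ x → ρ ⟨$⟩ˡ x ≡ ρ′ ⟨$⟩ˡ x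
≈⇒≈ˡ {ρ = ρ} {ρ′} ρ≈ρ′ x =
  trans (sym (inverseˡ ρ′)) (cong (ρ′ ⟨$⟩ˡ_) (trans (sym (ρ≈ρ′ (ρ ⟨$⟩ˡ x))) (inverseʳ ρ)))

adjacent⇒near : ∀ {n} {ρ ρ′ : Permutation′ n} → Adjacent ρ ρ′ → ∀ x →
                toℕ (ρ ⟨$⟩ˡ x) ≤ suc (toℕ (ρ′ ⟨$⟩ˡ x)) × toℕ (ρ′ ⟨$⟩ˡ x) ≤ suc (toℕ (ρ ⟨$⟩ˡ x))
adjacent⇒near {ρ = ρ} {ρ′} (ps , bound , far , follows) x =
  subst (λ r → r ≤ suc (toℕ p) × toℕ p ≤ suc r) (sym ρˡx≡swapped) (applySwaps-near far (toℕ p))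
  where
  p = ρ′ ⟨$⟩ˡ x
  swapped<n = applySwaps-< bound (toℕ<n p)
  q = fromℕ< swapped<n
  ρˡx≡swapped : toℕ (ρ ⟨$⟩ˡ x) ≡ applySwaps ps (toℕ p)
  ρˡx≡swapped = begin
    toℕ (ρ ⟨$⟩ˡ x)                   ≡⟨ cong (toℕ ∘ (ρ ⟨$⟩ˡ_)) (inverseʳ ρ′) ⟨
    toℕ (ρ ⟨$⟩ˡ (ρ′ ⟨$⟩ʳ p))          ≡⟨ cong (toℕ ∘ (ρ ⟨$⟩ˡ_)) (follows p q (toℕ-fromℕ< swapped<n)) ⟩
    toℕ (ρ ⟨$⟩ˡ (ρ ⟨$⟩ʳ q))           ≡⟨ cong toℕ (inverseˡ ρ) ⟩
    toℕ q                            ≡⟨ toℕ-fromℕ< swapped<n ⟩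
    applySwaps ps (toℕ p)            ∎
    where open ≡-Reasoning

trade-places : ∀ {y₀ z₀ y₁ z₁} → y₀ < z₀ → z₁ < y₁ → y₁ ≤ suc y₀ → z₀ ≤ suc z₁ →
               z₀ ≡ suc z₁ × y₁ ≡ suc y₀
trade-places y₀<z₀ z₁<y₁ y₁≤1+y₀ z₀≤1+z₁ =
  ≤-antisym z₀≤1+z₁ (≤-trans z₁<y₁ (≤-trans y₁≤1+y₀ y₀<z₀)) ,
  ≤-antisym y₁≤1+y₀ (≤-trans y₀<z₀ (≤-trans z₀≤1+z₁ z₁<y₁))

exit-time : ∀ {Q : ℕ → Set} → Decidable Q → ∀ {k} → Q 0 → ¬ Q k → ∃ λ t → t < k × Q t × ¬ Q (suc t)
exit-time Q? {zero}  q₀ ¬q₀ = contradiction q₀ ¬q₀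
exit-time Q? {suc k} q₀ ¬q₁₊ₖ with Q? k
... | yes qₖ = k , ≤-refl , qₖ , ¬q₁₊ₖ
... | no ¬qₖ = map₂ (map₁ m<n⇒m<1+n) (exit-time Q? q₀ ¬qₖ)

module Paths {n} {π : Permutation′ n} (T : Tangle π) where
  open Tangle T

  pos : ℕ → Fin n → ℕ
  pos t x = toℕ (τ t ⟨$⟩ˡ x)

  pos-start : ∀ x → pos 0 x ≡ toℕ (π ⟨$⟩ˡ x)
  pos-start x = cong toℕ (≈⇒≈ˡ {ρ = τ 0} {π} start x)

  pos-finish : ∀ x → pos m x ≡ toℕ x
  pos-finish x = cong toℕ (≈⇒≈ˡ {ρ = τ m} {Perm.id} finish x)

  pos-injective : ∀ t {x y} → pos t x ≡ pos t y → x ≡ y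
  pos-injective t e = trans (sym (inverseʳ (τ t))) (trans (cong (τ t ⟨$⟩ʳ_) (toℕ-injective e)) (inverseʳ (τ t)))

  step-start : ∀ x → step T x 0 ≡ 0ℤ
  step-start x =
    trans (cong (λ p → ℤ.+ pos 1 x ℤ.- ℤ.+ toℕ p) (≈⇒≈ˡ {ρ = τ 0} {τ 1} repFirst x)) (ℤ.+-inverseʳ (ℤ.+ pos 1 x))

  overtake : ∀ {t y z} → t < m → pos t y < pos t z → pos (suc t) z < pos (suc t) y →
             step T z t ≡ -1ℤ × step T y t ≡ 1ℤ
  overtake {t} {y} {z} t<m y<z z<y
    with trade-places y<z z<y (proj₂ (near y)) (proj₁ (near z))
    where near = adjacent⇒near {ρ = τ t} {τ (suc t)} (adjacent t t<m)
  ... | z-left , y-right rewrite z-left | y-right = +m-+[1+m]≡-1 (pos (suc t) z) , +[1+m]-+m≡1 (pos t y)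

  overtaken-eventually : ∀ {y z} → pos 0 y < pos 0 z → toℕ z < toℕ y →
                         ∃ λ t → t < m × step T z t ≡ -1ℤ × step T y t ≡ 1ℤ
  overtaken-eventually {y} {z} y<z z<y with exit-time (λ t → pos t y <? pos t z) y<z
    (<-asym (subst₂ _<_ (sym (pos-finish z)) (sym (pos-finish y)) z<y))
  ... | t , t<m , y<z′ , y≮z = t , t<m , overtake t<m y<z′
        (≤∧≢⇒< (≮⇒≥ y≮z) (<⇒≢ z<y ∘ cong toℕ ∘ pos-injective (suc t)))

  descending⇒three-corners : Descending3 π → ∃ λ x → 3 ≤ corners T x
  descending⇒three-corners (i , j , k , i<j , j<k , πk<πj , πj<πi)
    with overtaken-eventually {π ⟨$⟩ʳ i} {π ⟨$⟩ʳ j} (subst₂ _<_ (sym (start-at i)) (sym (start-at j)) i<j) πj<πi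
       | overtaken-eventually {π ⟨$⟩ʳ j} {π ⟨$⟩ʳ k} (subst₂ _<_ (sym (start-at j)) (sym (start-at k)) j<k) πk<πj
    where
    start-at : ∀ p → pos 0 (π ⟨$⟩ʳ p) ≡ toℕ p
    start-at p = trans (pos-start _) (cong toℕ (inverseˡ π))
  ... | t₁ , t₁<m , left , _ | t₂ , t₂<m , _ , right =
    π ⟨$⟩ʳ j , three≤variation (step T (π ⟨$⟩ʳ j)) (step-start _) left right (<⇒≤pred t₁<m) (<⇒≤pred t₂<m)

hasDirectTangle⇒avoids321 : ∀ {n} {π : Permutation′ n} → HasDirectTangle π → Avoids321 π
hasDirectTangle⇒avoids321 {π = π} (T , direct) contains
  with Paths.descending⇒three-corners T (contains321⇒descending {π = π} contains)
... | x , 3≤corners = ≤⇒≯ (direct x) 3≤corners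

theorem1 : (n : ℕ) (π : Permutation′ n) → HasDirectTangle π ⇔ Avoids321 π
theorem1 n π = mk⇔ hasDirectTangle⇒avoids321 (DirectTangle.hasDirectTangle π)
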